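{- Let $G$ be a closed $P$-oligomorphic permutation group of a countably infinite set $E$ whose nested block system consists of a single superblock, with maximal finite blocks $B_1,B_2,\dots$ of size $m$, and assume $G$ induces the full symmetric group on $\{B_1,B_2,\dots\}$. Fix an enumeration $b_{1,i},\dots,b_{m,i}$ of each block such that $L=\{b_{r,i}\mapsto b_{r,\sigma(i)}:\sigma\in\mathrm{Sym}(\{1,2,\dots\})\}\cong\mathrm{Id}_m\,\square\,\mathfrak S_\infty$ is contained in $G$, and let $S$ be the subgroup of $G$ stabilizing each block setwise. Then $G$ is the semidirect product $S\rtimes L$ (i.e. $S\trianglelefteq G$, $S\cap L=\{1\}$ and $G=SL$). In particular $G$ is uniquely determined by its tower: if $G'$ is another permutation group of $E$ satisfying the same hypotheses with the same blocks, containing the same $L$, and with the same tower (computed in $\mathrm{Sym}(\{1,\dots,m\})$ through the same enumeration), then $G'=G$.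
   Context: Profile: number of $G$-orbits on $n$-subsets; $P$-oligomorphic: polynomially bounded profile; closed: closed in $\mathrm{Sym}(E)$ for pointwise convergence. For $P$-oligomorphic $G$ there is a coarsest $G$-invariant partition of $E$ into finite blocks (maximal finite blocks); the nested block system consists of a single superblock when $G$ has no finite orbit of points and acts primitively on the infinite set of these blocks. An enumeration as in the claim exists under these hypotheses. Tower: for $i\ge0$, $H_i$ is the restriction to $B_{i+1}$ of the pointwise stabilizer in $S$ of $B_1\cup\dots\cup B_i$, identified with a subgroup of $\mathrm{Sym}(\{1,\dots,m\})$ via the enumeration. -}

module Defs where

open import Level using (0ℓ)
open import Data.Nat using (ℕ; zero; suc; _+_; _*_; _^_; _≤_; _<_)
open import Data.Fin using (Fin)
open import Data.Product using (Σ; ∃; ∃-syntax; _×_; _,_; proj₁; proj₂)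
open import Data.List using (List; length; map)
open import Data.List.Membership.Propositional using (_∈_)
open import Data.List.Relation.Unary.Any using (Any)
open import Data.List.Relation.Unary.Unique.Propositional using (Unique)
open import Relation.Nullary using (¬_)
open import Relation.Binary using (IsEquivalence)
open import Relation.Binary.PropositionalEquality using (_≡_; _≢_; refl; cong)
open import Function using (_∘_; Inverse; _↔_; _⇔_; mk↔ₛ′)
open import Function.Construct.Identity using (↔-id)
open import Function.Construct.Composition using (_↔-∘_)
open import Function.Construct.Symmetry using (↔-sym)

Perm : Set → Set
Perm E = E ↔ E

app : {E : Set} → Perm E → E → E
app g = Inverse.to g

_≈ₚ_ : {E : Set} → Perm E → Perm E → Set
g ≈ₚ h = ∀ x → app g x ≡ app h x

idP : {E : Set} → Perm E
idP {E} = ↔-id E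

-- composition: (g ∘ₚ h) x = g (h x)
_∘ₚ_ : {E : Set} → Perm E → Perm E → Perm E
g ∘ₚ h = g ↔-∘ h

invP : {E : Set} → Perm E → Perm E
invP = ↔-sym

PermSet : Set → Set₁
PermSet E = Perm E → Set

record IsPermGroup {E : Set} (G : PermSet E) : Set where
  field
    resp   : ∀ {g h} → g ≈ₚ h → G g → G h
    hasId  : G idP
    closed∘ : ∀ {g h} → G g → G h → G (g ∘ₚ h)
    closedInv : ∀ {g} → G g → G (invP g)

-- closed in Sym(E) for the topology of pointwise convergence:
-- every permutation which agrees on each finite set with some element
-- of G belongs to G
IsClosed : {E : Set} → PermSet E → Set
IsClosed {E} G =
  ∀ (g : Perm E) →
  (∀ (F : List E) → ∃[ h ] (G h × (∀ x → x ∈ F → app h x ≡ app g x))) →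
  G g

record Subset (E : Set) (n : ℕ) : Set where
  field
    elems  : List E
    unique : Unique elems
    size   : length elems ≡ n
open Subset public

SameOrbit : {E : Set} → PermSet E → {n : ℕ} → Subset E n → Subset E n → Set
SameOrbit {E} G A B =
  ∃[ g ] (G g × (∀ (y : E) → (y ∈ map (app g) (elems A)) ⇔ (y ∈ elems B)))

-- the profile n ↦ #(G-orbits on n-subsets) is at most f n :
-- there are at most f n n-subsets whose orbits cover all n-subsets
ProfileBoundedBy : {E : Set} → PermSet E → (ℕ → ℕ) → Set
ProfileBoundedBy {E} G f =
  ∀ (n : ℕ) → ∃[ reps ] ((length reps ≤ f n) ×
     (∀ (A : Subset E n) → Any (λ R → SameOrbit G R A) reps))

PO : {E : Set} → PermSet E → Set
PO G = ∃[ c ] ∃[ k ] ProfileBoundedBy G (λ n → c * (suc n) ^ k)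

-- G-invariant equivalence relation on E all of whose classes are finite
-- (= a G-invariant partition of E into finite blocks)
IsInvFinitePartition : {E : Set} → PermSet E → (E → E → Set) → Set
IsInvFinitePartition {E} G R =
  IsEquivalence R ×
  (∀ g → G g → ∀ x y → R x y → R (app g x) (app g y)) ×
  (∀ x → ∃[ F ] (∀ y → R x y → y ∈ F))

-- Setting: E enumerated as b_{r,i} = enum (r , i), r : Fin m, i : ℕ
-- (block B_{i+1} = { enum (r , i) | r : Fin m }, 0-indexed here)

module Setup {E : Set} {m : ℕ} (enum : (Fin m × ℕ) ↔ E) where

  pos : E → Fin m
  pos x = proj₁ (Inverse.from enum x)

  blk : E → ℕ
  blk x = proj₂ (Inverse.from enum x)

  SameBlock : E → E → Set
  SameBlock x y = blk x ≡ blk y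

  -- the blocks B_i are the maximal finite blocks of G, i.e. they form the
  -- coarsest G-invariant partition of E into finite blocks
  MaxFiniteBlocks : PermSet E → Set₁
  MaxFiniteBlocks G =
    IsInvFinitePartition G SameBlock ×
    (∀ (R : E → E → Set) → IsInvFinitePartition G R →
       ∀ x y → R x y → SameBlock x y)

  -- the nested block system consists of a single superblock:
  -- G has no finite orbit of points and acts primitively on the blocks
  NoFiniteOrbit : PermSet E → Set
  NoFiniteOrbit G =
    ∀ x → ¬ (∃[ F ] (∀ g → G g → app g x ∈ F))

  PrimitiveOnBlocks : PermSet E → Set₁
  PrimitiveOnBlocks G =
    ∀ (R : ℕ → ℕ → Set) → IsEquivalence R →
    (∀ g → G g → ∀ x y → R (blk x) (blk y) →
                          R (blk (app g x)) (blk (app g y))) →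
    (∃[ i ] ∃[ j ] (i ≢ j × R i j)) → ∀ i j → R i j

  SingleSuperblock : PermSet E → Set₁
  SingleSuperblock G = NoFiniteOrbit G × PrimitiveOnBlocks G

  FullSymOnBlocks : PermSet E → Set
  FullSymOnBlocks G =
    ∀ (σ : ℕ ↔ ℕ) → ∃[ g ] (G g × (∀ x → blk (app g x) ≡ Inverse.to σ (blk x)))

  liftL : ℕ ↔ ℕ → Perm E
  liftL σ = enum ↔-∘ (shift ↔-∘ ↔-sym enum)
    where
    shift : (Fin m × ℕ) ↔ (Fin m × ℕ)
    shift = mk↔ₛ′ (λ p → proj₁ p , Inverse.to σ (proj₂ p))
                  (λ p → proj₁ p , Inverse.from σ (proj₂ p))
                  (λ p → cong (proj₁ p ,_) (Inverse.strictlyInverseˡ σ (proj₂ p)))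
                  (λ p → cong (proj₁ p ,_) (Inverse.strictlyInverseʳ σ (proj₂ p)))

  L : PermSet E
  L g = ∃[ σ ] (g ≈ₚ liftL σ)

  Stab : PermSet E → PermSet E
  Stab G g = G g × (∀ x → blk (app g x) ≡ blk x)

  record Hyp (G : PermSet E) : Set₁ where
    field
      group       : IsPermGroup G
      closed      : IsClosed G
      polyOlig    : PO G
      maxBlocks   : MaxFiniteBlocks G
      superblock  : SingleSuperblock G
      fullSym     : FullSymOnBlocks G
      LinG        : ∀ g → L g → G g

  record SemidirectSL (G : PermSet E) : Set where
    field
      S-group   : IsPermGroup (Stab G)
      S-normal  : ∀ g s → G g → Stab G s → Stab G ((g ∘ₚ s) ∘ₚ invP g)
      S∩L       : ∀ g → Stab G g → L g → g ≈ₚ idP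
      G⊆SL      : ∀ g → G g → ∃[ s ] ∃[ l ] (Stab G s × L l × g ≈ₚ (s ∘ₚ l))
      SL⊆G      : ∀ s l → Stab G s → L l → G (s ∘ₚ l)

  -- the tower: H_i (i ≥ 0) is the restriction to B_{i+1} (here: block i)
  -- of the pointwise stabilizer in S of B_1 ∪ … ∪ B_i (here: blocks < i),
  -- read in Sym({1..m}) = Perm (Fin m) through the enumeration
  Tower : PermSet E → ℕ → Perm (Fin m) → Set
  Tower G i π =
    ∃[ g ] (Stab G g ×
            (∀ (r : Fin m) (j : ℕ) → j < i →
               app g (Inverse.to enum (r , j)) ≡ Inverse.to enum (r , j)) ×
            (∀ (r : Fin m) → app g (Inverse.to enum (r , i)) ≡
                              Inverse.to enum (app π r , i)))

  SameTower : PermSet E → PermSet E → Set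
  SameTower G G' = ∀ (i : ℕ) (π : Perm (Fin m)) → Tower G i π ⇔ Tower G' i π

-- G permutes its blocks, so composing g ∈ G with the inverse of the element of L
-- inducing the same permutation of blocks leaves an element of S; hence G = S L, and
-- S ∩ L = 1 because the only element of L fixing every block is the identity.
-- For uniqueness, G′ = S′ L, so it suffices that S′ ⊆ G. As G is closed, it is
-- enough to approximate each s ∈ S′ on blocks 0, …, k by elements of S. Conjugating
-- a commutator with transpositions of blocks turns the actions of s on blocks k and
-- k+1 into an element of S′ fixing blocks 0, …, k, i.e. an element of the tower;
-- the common tower realises it in S, and this extends the approximation by a block.

module Submission where

open import Defs
open import Data.Nat using (ℕ; NonZero; zero; suc; _<_; _≤_; s≤s)
open import Data.Nat.Properties using (_≟_; <⇒≢; n<1+n; <-trans; m<1+n⇒m<n∨m≡n; 1+n≢n)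
open import Data.Fin using (Fin; zero)
open import Data.Product using (_×_; _,_; proj₁; proj₂; ∃-syntax)
open import Data.Sum using (inj₁; inj₂)
open import Data.List using (List; map)
open import Data.List.Membership.Propositional using (_∈_)
open import Data.List.Membership.Propositional.Properties using (∈-map⁺)
import Data.List.Relation.Unary.All as All
open import Data.List.Extrema.Nat using (max; xs≤max)
open import Data.Empty using (⊥-elim; ⊥-elim-irr)
open import Function using (_∘_; _↔_; _⇔_; Inverse; Equivalence; mk⇔; mk↔ₛ′)
open import Relation.Binary.PropositionalEquality hiding (resp)
open import Relation.Nullary using (yes; no)

transpose : ℕ → ℕ → ℕ → ℕ
transpose a c x with x ≟ a
... | yes _ = c
... | no _ with x ≟ c
...   | yes _ = a
...   | no _  = x

transpose-applyˡ : ∀ a c → transpose a c a ≡ c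
transpose-applyˡ a c with a ≟ a
... | yes _   = refl
... | no a≢a = ⊥-elim (a≢a refl)

transpose-applyʳ : ∀ a c → transpose a c c ≡ a
transpose-applyʳ a c with c ≟ a
... | yes c≡a = c≡a
... | no _ with c ≟ c
...   | yes _   = refl
...   | no c≢c = ⊥-elim (c≢c refl)

transpose-fix : ∀ {a c x} → x ≢ a → x ≢ c → transpose a c x ≡ x
transpose-fix {a} {c} {x} x≢a x≢c with x ≟ a
... | yes x≡a = ⊥-elim (x≢a x≡a)
... | no _ with x ≟ c
...   | yes x≡c = ⊥-elim (x≢c x≡c)
...   | no _    = refl

transpose-involutive : ∀ a c x → transpose a c (transpose a c x) ≡ x
transpose-involutive a c x with x ≟ a
... | yes refl = transpose-applyʳ x c
... | no x≢a with x ≟ c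
...   | yes refl = transpose-applyˡ a x
...   | no x≢c   = transpose-fix x≢a x≢c

transposition : ℕ → ℕ → ℕ ↔ ℕ
transposition a c =
  mk↔ₛ′ (transpose a c) (transpose a c) (transpose-involutive a c) (transpose-involutive a c)

bounded-on-list : ∀ {A : Set} (f : A → ℕ) (xs : List A) → ∃[ n ] (∀ {x} → x ∈ xs → f x ≤ n)
bounded-on-list f xs =
  max 0 (map f xs) , λ x∈xs → All.lookup (xs≤max 0 (map f xs)) (∈-map⁺ f x∈xs)

module _ {E : Set} where

  app-invˡ : ∀ (g : Perm E) x → app g (app (invP g) x) ≡ x
  app-invˡ g = Inverse.strictlyInverseˡ g

  app-invʳ : ∀ (g : Perm E) x → app (invP g) (app g x) ≡ x
  app-invʳ g = Inverse.strictlyInverseʳ g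

  inv-fix : ∀ (g : Perm E) {x} → app g x ≡ x → app (invP g) x ≡ x
  inv-fix g {x} gx≡x = trans (cong (app (invP g)) (sym gx≡x)) (app-invʳ g x)

  -- Opaque because otherwise the conversion checker unfolds conjugates of
  -- concrete permutations all the way to Inverse records, which is very slow.
  opaque
    conjugate : Perm E → Perm E → Perm E
    conjugate g h = (g ∘ₚ h) ∘ₚ invP g

    conjugate-apply : ∀ g h x → app (conjugate g h) x ≡ app g (app h (app (invP g) x))
    conjugate-apply g h x = refl

    conjugate∈ : ∀ {G : PermSet E} → IsPermGroup G → ∀ {g h} → G g → G h → G (conjugate g h)
    conjugate∈ group g∈G h∈G = closed∘ (closed∘ g∈G h∈G) (closedInv g∈G)
      where open IsPermGroup group

  commutator : Perm E → Perm E → Perm E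
  commutator g h = g ∘ₚ conjugate h (invP g)

  commutator∈ : ∀ {G : PermSet E} → IsPermGroup G → ∀ {g h} → G g → G h → G (commutator g h)
  commutator∈ group g∈G h∈G = closed∘ g∈G (conjugate∈ group h∈G (closedInv g∈G))
    where open IsPermGroup group

module Blocks {E : Set} {m : ℕ} (enum : (Fin m × ℕ) ↔ E) where
  open Setup enum

  b : Fin m → ℕ → E
  b r i = Inverse.to enum (r , i)

  blk-b : ∀ r i → blk (b r i) ≡ i
  blk-b r i = cong proj₂ (Inverse.strictlyInverseʳ enum (r , i))

  pos-b : ∀ r i → pos (b r i) ≡ r
  pos-b r i = cong proj₁ (Inverse.strictlyInverseʳ enum (r , i))

  b-pos : ∀ x {i} → blk x ≡ i → b (pos x) i ≡ x
  b-pos x refl = Inverse.strictlyInverseˡ enum x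

  BlocksInvariant : PermSet E → Set
  BlocksInvariant G = ∀ g → G g → ∀ x y → SameBlock x y → SameBlock (app g x) (app g y)

  PreservesBlocks : Perm E → Set
  PreservesBlocks g = ∀ x → blk (app g x) ≡ blk x

  preservesBlocks-inv : ∀ g → PreservesBlocks g → PreservesBlocks (invP g)
  preservesBlocks-inv g g-pb x = trans (sym (g-pb _)) (cong blk (app-invˡ g x))

  preservesBlocks-∘ : ∀ g h → PreservesBlocks g → PreservesBlocks h → PreservesBlocks (g ∘ₚ h)
  preservesBlocks-∘ g h g-pb h-pb x = trans (g-pb _) (h-pb x)

  AgreeBelow : ℕ → Perm E → Perm E → Set
  AgreeBelow n g h = ∀ r j → j < n → app g (b r j) ≡ app h (b r j)

  -- Definitionally the fixing condition in Setup.Tower.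
  FixesBlocksBelow : ℕ → Perm E → Set
  FixesBlocksBelow n g = AgreeBelow n g idP

  agreeBelow-apply : ∀ g h {n x} → AgreeBelow n g h → blk x < n → app g x ≡ app h x
  agreeBelow-apply g h {x = x} agree x<n =
    subst (λ y → app g y ≡ app h y) (b-pos x refl) (agree (pos x) (blk x) x<n)

  liftL-b : ∀ σ r i → app (liftL σ) (b r i) ≡ b r (Inverse.to σ i)
  liftL-b σ r i = cong₂ (λ r′ i′ → b r′ (Inverse.to σ i′)) (pos-b r i) (blk-b r i)

  liftL-fix : ∀ σ x → Inverse.to σ (blk x) ≡ blk x → app (liftL σ) x ≡ x
  liftL-fix σ x σx≡x = trans (cong (b (pos x)) σx≡x) (b-pos x refl)

  liftL-fix-b : ∀ σ r {j} → Inverse.to σ j ≡ j → app (liftL σ) (b r j) ≡ b r j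
  liftL-fix-b σ r σj≡j = trans (liftL-b σ r _) (cong (b r) σj≡j)

  conjugate-liftL-preservesBlocks : ∀ σ t → PreservesBlocks t → PreservesBlocks (conjugate (liftL σ) t)
  conjugate-liftL-preservesBlocks σ t t-pb x = begin
    blk (app (conjugate (liftL σ) t) x)       ≡⟨ cong blk (conjugate-apply (liftL σ) t x) ⟩
    blk (b _ (Inverse.to σ (blk (app t y))))  ≡⟨ blk-b _ _ ⟩
    Inverse.to σ (blk (app t y))              ≡⟨ cong (Inverse.to σ) (trans (t-pb y) (blk-b _ _)) ⟩
    Inverse.to σ (Inverse.from σ (blk x))     ≡⟨ Inverse.strictlyInverseˡ σ (blk x) ⟩
    blk x                                     ∎
    where
    open ≡-Reasoning
    y = app (invP (liftL σ)) x

  commutator-liftL-preservesBlocks : ∀ t σ → PreservesBlocks t → PreservesBlocks (commutator t (liftL σ))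
  commutator-liftL-preservesBlocks t σ t-pb x =
    trans (t-pb _) (conjugate-liftL-preservesBlocks σ (invP t) (preservesBlocks-inv t t-pb) x)

  commutator-liftL-fix : ∀ t σ → PreservesBlocks t → ∀ r {j} → Inverse.to σ j ≡ j →
                         app (commutator t (liftL σ)) (b r j) ≡ b r j
  commutator-liftL-fix t σ t-pb r {j} σj≡j = begin
    app t (app (conjugate l (invP t)) (b r j))           ≡⟨ cong (app t) (conjugate-apply l (invP t) _) ⟩
    app t (app l (app (invP t) (app (invP l) (b r j))))  ≡⟨ cong (app t ∘ app l ∘ app (invP t)) (inv-fix l (liftL-fix-b σ r σj≡j)) ⟩
    app t (app l (app (invP t) (b r j)))                 ≡⟨ cong (app t) (liftL-fix σ _ σ-fixes) ⟩
    app t (app (invP t) (b r j))                         ≡⟨ app-invˡ t _ ⟩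
    b r j                                                ∎
    where
    open ≡-Reasoning
    l = liftL σ
    σ-fixes : Inverse.to σ (blk (app (invP t) (b r j))) ≡ blk (app (invP t) (b r j))
    σ-fixes = subst (λ i → Inverse.to σ i ≡ i)
                    (sym (trans (preservesBlocks-inv t t-pb _) (blk-b r j))) σj≡j

  restrict : (t : Perm E) → PreservesBlocks t → ℕ → Perm (Fin m)
  restrict t t-pb i =
    mk↔ₛ′ (onBlock t) (onBlock (invP t))
          (onBlock-cancel t (invP t) (preservesBlocks-inv t t-pb) (app-invˡ t))
          (onBlock-cancel (invP t) t t-pb (app-invʳ t))
    where
    onBlock : Perm E → Fin m → Fin m
    onBlock g r = pos (app g (b r i))

    onBlock-cancel : ∀ g h → PreservesBlocks h → (∀ x → app g (app h x) ≡ x) →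
                     ∀ r → onBlock g (onBlock h r) ≡ r
    onBlock-cancel g h h-pb gh≗id r = begin
      pos (app g (b (pos (app h (b r i))) i))  ≡⟨ cong (pos ∘ app g) (b-pos _ (trans (h-pb _) (blk-b r i))) ⟩
      pos (app g (app h (b r i)))              ≡⟨ cong pos (gh≗id _) ⟩
      pos (b r i)                              ≡⟨ pos-b r i ⟩
      r                                        ∎
      where open ≡-Reasoning

  restrict-b : ∀ t (t-pb : PreservesBlocks t) i r →
               app t (b r i) ≡ b (Inverse.to (restrict t t-pb i) r) i
  restrict-b t t-pb i r = sym (b-pos _ (trans (t-pb _) (blk-b r i)))

  -- With τ = (k k+1) and ρ = (k k+2) acting on block indices, [t , τ] moves only
  -- blocks k and k+1, so Δ t k = ρ [t , τ] ρ⁻¹ fixes every block ≤ k, while on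
  -- block k+1 it undoes t on block k and then applies t on block k+1.
  Δ : Perm E → ℕ → Perm E
  Δ t k = conjugate (liftL (transposition k (suc (suc k)))) (commutator t (liftL (transposition k (suc k))))

  Δ-fixesBlocksBelow : ∀ t → PreservesBlocks t → ∀ k → FixesBlocksBelow (suc k) (Δ t k)
  Δ-fixesBlocksBelow t t-pb k r j j<1+k with m<1+n⇒m<n∨m≡n j<1+k
  ... | inj₁ j<k = begin
    app (Δ t k) (b r j)                   ≡⟨ conjugate-apply ρ c _ ⟩
    app ρ (app c (app (invP ρ) (b r j)))  ≡⟨ cong (app ρ ∘ app c) (inv-fix ρ ρ-fix) ⟩
    app ρ (app c (b r j))                 ≡⟨ cong (app ρ) (commutator-liftL-fix t τσ t-pb r τ-fix) ⟩
    app ρ (b r j)                         ≡⟨ ρ-fix ⟩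
    b r j                                 ∎
    where
    open ≡-Reasoning
    τσ = transposition k (suc k)
    ρσ = transposition k (suc (suc k))
    ρ = liftL ρσ
    c = commutator t (liftL τσ)
    ρ-fix : app ρ (b r j) ≡ b r j
    ρ-fix = liftL-fix-b ρσ r (transpose-fix (<⇒≢ j<k) (<⇒≢ (<-trans j<k (<-trans (n<1+n k) (n<1+n (suc k))))))
    τ-fix : transpose k (suc k) j ≡ j
    τ-fix = transpose-fix (<⇒≢ j<k) (<⇒≢ (<-trans j<k (n<1+n k)))
  ... | inj₂ refl = begin
    app (Δ t k) (b r k)                   ≡⟨ conjugate-apply ρ c _ ⟩
    app ρ (app c (app (invP ρ) (b r k)))  ≡⟨ cong (app ρ ∘ app c) (trans (liftL-b ρσ r k) (cong (b r) (transpose-applyˡ k (suc (suc k))))) ⟩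
    app ρ (app c (b r (suc (suc k))))     ≡⟨ cong (app ρ) (commutator-liftL-fix t τσ t-pb r τ-fix) ⟩
    app ρ (b r (suc (suc k)))             ≡⟨ trans (liftL-b ρσ r _) (cong (b r) (transpose-applyʳ k (suc (suc k)))) ⟩
    b r k                                 ∎
    where
    open ≡-Reasoning
    τσ = transposition k (suc k)
    ρσ = transposition k (suc (suc k))
    ρ = liftL ρσ
    c = commutator t (liftL τσ)
    τ-fix : transpose k (suc k) (suc (suc k)) ≡ suc (suc k)
    τ-fix = transpose-fix (λ eq → <⇒≢ (<-trans (n<1+n k) (n<1+n (suc k))) (sym eq)) 1+n≢n

  Δ-next : ∀ t → PreservesBlocks t → ∀ k r →
           app (Δ t k) (b (pos (app t (b r k))) (suc k)) ≡ app t (b r (suc k))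
  Δ-next t t-pb k r = begin
    app (Δ t k) (b q (suc k))
      ≡⟨ conjugate-apply ρ c _ ⟩
    app ρ (app c (app (invP ρ) (b q (suc k))))
      ≡⟨ cong (app ρ ∘ app c) (inv-fix ρ (liftL-fix-b ρσ q ρ-fix)) ⟩
    app ρ (app t (app (conjugate τ (invP t)) (b q (suc k))))
      ≡⟨ cong (app ρ ∘ app t) (conjugate-apply τ (invP t) _) ⟩
    app ρ (app t (app τ (app (invP t) (app (invP τ) (b q (suc k))))))
      ≡⟨ cong (app ρ ∘ app t ∘ app τ ∘ app (invP t)) τ⁻¹-moves ⟩
    app ρ (app t (app τ (app (invP t) (app t (b r k)))))
      ≡⟨ cong (app ρ ∘ app t ∘ app τ) (app-invʳ t _) ⟩
    app ρ (app t (app τ (b r k)))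
      ≡⟨ cong (app ρ ∘ app t) (trans (liftL-b τσ r k) (cong (b r) (transpose-applyˡ k (suc k)))) ⟩
    app ρ (app t (b r (suc k)))
      ≡⟨ liftL-fix ρσ _ (subst (λ i → transpose k (suc (suc k)) i ≡ i) (sym (trans (t-pb _) (blk-b r _))) ρ-fix) ⟩
    app t (b r (suc k))
      ∎
    where
    open ≡-Reasoning
    q = pos (app t (b r k))
    τσ = transposition k (suc k)
    ρσ = transposition k (suc (suc k))
    τ = liftL τσ
    ρ = liftL ρσ
    c = commutator t τ
    ρ-fix : transpose k (suc (suc k)) (suc k) ≡ suc k
    ρ-fix = transpose-fix 1+n≢n (λ eq → 1+n≢n (sym eq))
    τ⁻¹-moves : app (invP τ) (b q (suc k)) ≡ app t (b r k)
    τ⁻¹-moves = trans (liftL-b τσ q _)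
                      (trans (cong (b q) (transpose-applyʳ k (suc k))) (b-pos _ (trans (t-pb _) (blk-b r k))))

  Δ-preservesBlocks : ∀ t → PreservesBlocks t → ∀ k → PreservesBlocks (Δ t k)
  Δ-preservesBlocks t t-pb k =
    conjugate-liftL-preservesBlocks (transposition k (suc (suc k))) (commutator t (liftL (transposition k (suc k))))
      (commutator-liftL-preservesBlocks t (transposition k (suc k)) t-pb)

  Δ∈ : ∀ {G : PermSet E} → IsPermGroup G → (∀ σ → G (liftL σ)) → ∀ {t} → G t → ∀ k → G (Δ t k)
  Δ∈ group liftL∈G t∈G k =
    conjugate∈ group (liftL∈G (transposition k (suc (suc k))))
      (commutator∈ group t∈G (liftL∈G (transposition k (suc k))))

  module WithinGroup {G : PermSet E} (group : IsPermGroup G) (L⊆G : ∀ g → L g → G g) where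
    open IsPermGroup group

    liftL∈G : ∀ σ → G (liftL σ)
    liftL∈G σ = L⊆G _ (σ , λ _ → refl)

    Stab-isPermGroup : IsPermGroup (Stab G)
    Stab-isPermGroup = record
      { resp      = λ g≈h (g∈G , g-pb) → resp g≈h g∈G , λ x → trans (cong blk (sym (g≈h x))) (g-pb x)
      ; hasId     = hasId , λ _ → refl
      ; closed∘   = λ {g} {h} (g∈G , g-pb) (h∈G , h-pb) → closed∘ g∈G h∈G , preservesBlocks-∘ g h g-pb h-pb
      ; closedInv = λ {g} (g∈G , g-pb) → closedInv g∈G , preservesBlocks-inv g g-pb
      }

    Δ∈Stab : ∀ {t} → Stab G t → ∀ k → Stab G (Δ t k)
    Δ∈Stab {t} (t∈G , t-pb) k = Δ∈ group liftL∈G t∈G k , Δ-preservesBlocks t t-pb k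

    module Decomposition (invariant : BlocksInvariant G) (r₀ : Fin m) where

      blockPermutation : ∀ {g} → G g → ℕ ↔ ℕ
      blockPermutation {g} g∈G =
        mk↔ₛ′ (onBlocks g) (onBlocks (invP g))
              (onBlocks-cancel g (invP g) g∈G (app-invˡ g))
              (onBlocks-cancel (invP g) g (closedInv g∈G) (app-invʳ g))
        where
        onBlocks : Perm E → ℕ → ℕ
        onBlocks h i = blk (app h (b r₀ i))

        onBlocks-cancel : ∀ h h′ → G h → (∀ x → app h (app h′ x) ≡ x) →
                          ∀ i → onBlocks h (onBlocks h′ i) ≡ i
        onBlocks-cancel h h′ h∈G hh′≗id i = begin
          blk (app h (b r₀ (blk (app h′ (b r₀ i)))))  ≡⟨ invariant h h∈G _ _ (blk-b r₀ _) ⟩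
          blk (app h (app h′ (b r₀ i)))              ≡⟨ cong blk (hh′≗id _) ⟩
          blk (b r₀ i)                               ≡⟨ blk-b r₀ i ⟩
          i                                          ∎
          where open ≡-Reasoning

      blockPermutation-blk : ∀ {g} (g∈G : G g) x →
                             blk (app g x) ≡ Inverse.to (blockPermutation g∈G) (blk x)
      blockPermutation-blk {g} g∈G x = invariant g g∈G x (b r₀ (blk x)) (sym (blk-b r₀ _))

      Stab-normal : ∀ g s → G g → Stab G s → Stab G ((g ∘ₚ s) ∘ₚ invP g)
      Stab-normal g s g∈G (s∈G , s-pb) =
        closed∘ (closed∘ g∈G s∈G) (closedInv g∈G) ,
        λ x → trans (invariant g g∈G _ _ (s-pb _)) (cong blk (app-invˡ g x))

      Stab∩L≈id : ∀ g → Stab G g → L g → g ≈ₚ idP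
      Stab∩L≈id g (_ , g-pb) (σ , g≈lσ) x = trans (g≈lσ x) (liftL-fix σ x σ-fixes)
        where
        σ-fixes : Inverse.to σ (blk x) ≡ blk x
        σ-fixes = trans (sym (blk-b (pos x) _)) (trans (cong blk (sym (g≈lσ x))) (g-pb x))

      G⊆SL : ∀ g → G g → ∃[ s ] ∃[ l ] (Stab G s × L l × g ≈ₚ (s ∘ₚ l))
      G⊆SL g g∈G =
        g ∘ₚ invP l , l ,
        (closed∘ g∈G (closedInv (liftL∈G σ)) , s-pb) ,
        (σ , λ _ → refl) ,
        λ x → sym (cong (app g) (app-invʳ l x))
        where
        σ = blockPermutation g∈G
        l = liftL σ
        s-pb : PreservesBlocks (g ∘ₚ invP l)
        s-pb x = begin
          blk (app g (app (invP l) x))           ≡⟨ blockPermutation-blk g∈G _ ⟩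
          Inverse.to σ (blk (app (invP l) x))    ≡⟨ cong (Inverse.to σ) (blk-b (pos x) _) ⟩
          Inverse.to σ (Inverse.from σ (blk x))  ≡⟨ Inverse.strictlyInverseˡ σ (blk x) ⟩
          blk x                                  ∎
          where open ≡-Reasoning

      semidirect : SemidirectSL G
      semidirect = record
        { S-group  = Stab-isPermGroup
        ; S-normal = Stab-normal
        ; S∩L      = Stab∩L≈id
        ; G⊆SL     = G⊆SL
        ; SL⊆G     = λ s l (s∈G , _) l∈L → closed∘ s∈G (L⊆G l l∈L)
        }

  module Reconstruction
      {G G′ : PermSet E}
      (G-group : IsPermGroup G) (L⊆G : ∀ g → L g → G g) (G-closed : IsClosed G)
      (G′-group : IsPermGroup G′) (L⊆G′ : ∀ g → L g → G′ g)
      (towers : ∀ i π → Tower G′ i π → Tower G i π) where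

    open IsPermGroup G-group
    open WithinGroup G-group L⊆G using (Stab-isPermGroup; Δ∈Stab)
    open WithinGroup G′-group L⊆G′ using () renaming (Δ∈Stab to Δ∈Stab′)
    module S = IsPermGroup Stab-isPermGroup

    ApproximableBelow : ℕ → Perm E → Set
    ApproximableBelow n s = ∃[ h ] (Stab G h × AgreeBelow n h s)

    TowerMatch : ℕ → Perm E → Set
    TowerMatch i t = ∃[ a ] (Stab G a × FixesBlocksBelow i a × (∀ r → app a (b r i) ≡ app t (b r i)))

    towerMatch : ∀ {t} i → Stab G′ t → FixesBlocksBelow i t → TowerMatch i t
    towerMatch {t} i (t∈G′ , t-pb) t-fix =
      readOff (towers i (restrict t t-pb i) (t , (t∈G′ , t-pb) , t-fix , restrict-b t t-pb i))
      where
      readOff : Tower G i (restrict t t-pb i) → TowerMatch i t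
      readOff (a , a∈S , a-fix , a-b) = a , a∈S , a-fix , λ r → trans (a-b r) (sym (restrict-b t t-pb i r))

    -- Δ s k ∈ S′ and Δ h k ∈ S fix the blocks ≤ k and act on block k+1 as s₍ₖ₊₁₎ s₍ₖ₎⁻¹
    -- and h₍ₖ₊₁₎ h₍ₖ₎⁻¹. The towers give a ∈ S acting there like Δ s k, and as
    -- h₍ₖ₎ = s₍ₖ₎, the element a (Δ h k)⁻¹ h acts on block k+1 as s₍ₖ₊₁₎.
    extendAgreement : ∀ {s} k → Stab G′ s → ApproximableBelow (suc k) s → ApproximableBelow (suc (suc k)) s
    extendAgreement {s} k s∈S′@(_ , s-pb) (h , h∈S@(_ , h-pb) , h≈s) =
      correct (towerMatch (suc k) (Δ∈Stab′ s∈S′ k) (Δ-fixesBlocksBelow s s-pb k))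
      where
      open ≡-Reasoning

      correct : TowerMatch (suc k) (Δ s k) → ApproximableBelow (suc (suc k)) s
      correct (a , a∈S , a-fix , a≈Δs) =
        (a ∘ₚ invP (Δ h k)) ∘ₚ h , S.closed∘ (S.closed∘ a∈S (S.closedInv (Δ∈Stab h∈S k))) h∈S , agree
        where
        agree-below : ∀ r j → j < suc k → app a (app (invP (Δ h k)) (app h (b r j))) ≡ app s (b r j)
        agree-below r j j<1+k = begin
          app a (app (invP (Δ h k)) (app h (b r j)))  ≡⟨ cong (app a ∘ app (invP (Δ h k))) (h≈s r j j<1+k) ⟩
          app a (app (invP (Δ h k)) w)                ≡⟨ cong (app a) (inv-fix (Δ h k) (agreeBelow-apply (Δ h k) idP (Δ-fixesBlocksBelow h h-pb k) w<1+k)) ⟩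
          app a w                                     ≡⟨ agreeBelow-apply a idP a-fix w<1+k ⟩
          w                                           ∎
          where
          w = app s (b r j)
          w<1+k : blk w < suc k
          w<1+k = subst (_< suc k) (sym (trans (s-pb _) (blk-b r j))) j<1+k

        agree-next : ∀ r → app a (app (invP (Δ h k)) (app h (b r (suc k)))) ≡ app s (b r (suc k))
        agree-next r = begin
          app a (app (invP (Δ h k)) (app h (b r (suc k))))
            ≡⟨ cong (app a ∘ app (invP (Δ h k))) (sym (Δ-next h h-pb k r)) ⟩
          app a (app (invP (Δ h k)) (app (Δ h k) (b (pos (app h (b r k))) (suc k))))
            ≡⟨ cong (app a) (app-invʳ (Δ h k) _) ⟩
          app a (b (pos (app h (b r k))) (suc k))
            ≡⟨ cong (λ x → app a (b (pos x) (suc k))) (h≈s r k (n<1+n k)) ⟩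
          app a (b (pos (app s (b r k))) (suc k))
            ≡⟨ a≈Δs _ ⟩
          app (Δ s k) (b (pos (app s (b r k))) (suc k))
            ≡⟨ Δ-next s s-pb k r ⟩
          app s (b r (suc k))
            ∎

        agree : AgreeBelow (suc (suc k)) ((a ∘ₚ invP (Δ h k)) ∘ₚ h) s
        agree r j j<2+k with m<1+n⇒m<n∨m≡n j<2+k
        ... | inj₁ j<1+k = agree-below r j j<1+k
        ... | inj₂ refl  = agree-next r

    approximate : ∀ {s} → Stab G′ s → ∀ k → ApproximableBelow (suc k) s
    approximate {s} s∈S′ zero = base (towerMatch 0 s∈S′ (λ _ _ ()))
      where
      base : TowerMatch 0 s → ApproximableBelow 1 s
      base (a , a∈S , _ , a≈s) = a , a∈S , λ { r zero _ → a≈s r ; r (suc _) (s≤s ()) }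
    approximate s∈S′ (suc k) = extendAgreement k s∈S′ (approximate s∈S′ k)

    Stab′⊆G : ∀ {s} → Stab G′ s → G s
    Stab′⊆G {s} s∈S′ = G-closed s λ F →
      let (n , F≤n)       = bounded-on-list blk F
          (h , h∈S , h≈s) = approximate s∈S′ n
      in h , proj₁ h∈S , λ x x∈F → agreeBelow-apply h s h≈s (s≤s (F≤n x∈F))

    G′⊆G : BlocksInvariant G′ → Fin m → ∀ g → G′ g → G g
    G′⊆G G′-invariant r₀ g g∈G′ = fromDecomposition (G′⊆S′L g g∈G′)
      where
      open WithinGroup.Decomposition G′-group L⊆G′ G′-invariant r₀ using () renaming (G⊆SL to G′⊆S′L)
      fromDecomposition : ∃[ s ] ∃[ l ] (Stab G′ s × L l × g ≈ₚ (s ∘ₚ l)) → G g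
      fromDecomposition (s , l , s∈S′ , l∈L , g≈sl) =
        resp (λ x → sym (g≈sl x)) (closed∘ (Stab′⊆G s∈S′) (L⊆G l l∈L))

blocksInvariant : ∀ {E m} {enum : (Fin m × ℕ) ↔ E} {G} → Setup.Hyp enum G → Blocks.BlocksInvariant enum G
blocksInvariant H = proj₁ (proj₂ (proj₁ (Setup.Hyp.maxBlocks H)))

proposition4p19 :
    (m : ℕ) → .{{_ : NonZero m}} → (E : Set) → (enum : (Fin m × ℕ) ↔ E) →
    (G : PermSet E) → Setup.Hyp enum G →
    Setup.SemidirectSL enum G ×
    (∀ (G' : PermSet E) → Setup.Hyp enum G' → Setup.SameTower enum G G' →
       ∀ (g : Perm E) → G' g ⇔ G g)
proposition4p19 zero {{m≢0}} _ _ _ _ = ⊥-elim-irr (NonZero.nonZero m≢0)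
proposition4p19 (suc _) E enum G H =
  Decomposition.semidirect ,
  λ G′ H′ same g → mk⇔ (⊆-from-towers H′ H (λ i π → Equivalence.from (same i π)) g)
                       (⊆-from-towers H H′ (λ i π → Equivalence.to (same i π)) g)
  where
  open Blocks enum
  open Setup.Hyp
  module Decomposition = WithinGroup.Decomposition (group H) (LinG H) (blocksInvariant H) zero
  ⊆-from-towers : ∀ {G₁ G₂} → Setup.Hyp enum G₁ → Setup.Hyp enum G₂ →
                  (∀ i π → Setup.Tower enum G₁ i π → Setup.Tower enum G₂ i π) → ∀ g → G₁ g → G₂ g
  ⊆-from-towers H₁ H₂ towers =
    Reconstruction.G′⊆G (group H₂) (LinG H₂) (closed H₂) (group H₁) (LinG H₁) towers (blocksInvariant H₁) zero
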